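{- Let $m$ be a positive integer, $k\ge4$, and let $G$ be the cycle $v_1v_2\cdots v_kv_1$. Let $f\in\mathbb{N}^{V(G)}$ satisfy $f(v_i)\in\{3m,5m\}$ for all $i\in\{1,\dots,k\}$ and $f(v_i)+f(v_{i+1})\ge 8m$ for all $i\in\{1,\dots,k\}$ (indices modulo $k$). Then $G$ is $(f,2m)$-DP-colorable.
   Context: A cover of $G$ is $(L,H)$ with $\{L(u)\}$ a partition of $V(H)$, $H$-edges between $L(u)$ and $L(v)$ only if $v\in N_G[u]$, each $H[L(u)]$ complete, and for $uv\in E(G)$ the $H$-edges between $L(u),L(v)$ forming a matching; an $f$-cover has $|L(v)|=f(v)$. $S\subseteq V(H)$ is quasi-independent if it contains no $H$-edge between distinct parts. For $g\in\mathbb{N}^{V(G)}$, an $(\mathcal{H},g)$-coloring is a quasi-independent $S\subseteq V(H)$ with $|S\cap L(v)|=g(v)$ for all $v$. $G$ is $(f,g)$-DP-colorable if it has an $(\mathcal{H},g)$-coloring for every $f$-cover $\mathcal{H}$; a constant $2m$ denotes the constant function. -}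

module Defs where

open import Data.Nat using (ℕ; zero; suc; _+_; _*_; _≤_)
open import Data.Fin using (Fin; toℕ)
open import Data.Fin.Subset using (Subset; _∈_; ∣_∣)
open import Data.Bool using (Bool; true; false)
open import Data.Product using (_×_)
open import Data.Sum using (_⊎_)
open import Relation.Binary.PropositionalEquality using (_≡_; _≢_)

-- An f-cover (L,H): V(H) = Σ v (Fin (f v)), with L(v) = {v} × Fin (f v)
-- (every f-cover is isomorphic to one of this form).
record Cover (n : ℕ) (Adj : Fin n → Fin n → Set) (f : Fin n → ℕ) : Set where
  field
    E          : (u : Fin n) → Fin (f u) → (v : Fin n) → Fin (f v) → Bool
    E-sym      : ∀ u a v b → E u a v b ≡ E v b u a
    E-irrefl   : ∀ u a → E u a u a ≡ false
    E-closedNbhd : ∀ u a v b → E u a v b ≡ true → (u ≡ v) ⊎ Adj u v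
    E-complete : ∀ u a b → a ≢ b → E u a u b ≡ true
    E-matching : ∀ u v → Adj u v → ∀ a b c →
                 E u a v b ≡ true → E u a v c ≡ true → b ≡ c

open Cover public

record Coloring {n : ℕ} {Adj : Fin n → Fin n → Set} {f : Fin n → ℕ}
                (H : Cover n Adj f) (g : Fin n → ℕ) : Set where
  field
    S          : (v : Fin n) → Subset (f v)
    quasiIndep : ∀ u a v b → u ≢ v → a ∈ S u → b ∈ S v → E H u a v b ≡ false
    size       : ∀ v → ∣ S v ∣ ≡ g v

DPColorable : (n : ℕ) (Adj : Fin n → Fin n → Set) (f g : Fin n → ℕ) → Set
DPColorable n Adj f g = (H : Cover n Adj f) → Coloring H g

CycNext : (k : ℕ) → Fin k → Fin k → Set
CycNext k i j = (suc (toℕ i) ≡ toℕ j) ⊎ ((suc (toℕ i) ≡ k) × (toℕ j ≡ 0))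

CycAdj : (k : ℕ) → Fin k → Fin k → Set
CycAdj k i j = CycNext k i j ⊎ CycNext k j i

module Submission where

-- The vertices with f v = 3m are pairwise non-adjacent. Label the vertices early or late so that
-- late vertices have f v = 5m and two early neighbours, and early vertices come in runs of one or
-- two, a run of two starting with a vertex of f v = 5m. Early vertices are coloured first, late ones
-- last. The two early neighbours of a late vertex may forbid 2m + 2m of its 5m colours, m too many;
-- so beforehand every late vertex reserves at most m colours of each neighbour, chosen such that any
-- colourings of the neighbours containing the reservations forbid at most 3m of its colours (a colour
-- reserved on one side forbids the same colour as its partner on the other side, or none at all).
-- The reservations on a run of two early vertices must not clash. The late vertices reserve one
-- after another, each avoiding clashes with the reservations already made; this costs at most 2m
-- of the at least 8m colours of its neighbours. Only a late vertex between two 3m-vertices cannot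
-- afford it, and those reserve first: they never sit before a run of two.

open import Defs
open import Data.Bool using (Bool; true; false; not; _∧_; _∨_; if_then_else_) renaming (_≟_ to _≟ᵇ_)
open import Data.Bool.Properties
  using (∨-zeroʳ; ∨-identityʳ; ∨-conicalˡ; ∨-conicalʳ; ∧-conicalˡ; ∧-conicalʳ; ∧-zeroʳ; not-injective; ¬-not)
open import Data.Empty using (⊥; ⊥-elim)
open import Data.Fin using (Fin; zero; suc; toℕ; fromℕ; fromℕ<; inject₁) renaming (_≟_ to _≟ᶠ_)
open import Data.Fin.Properties
  using (suc-injective; 0≢1+n; toℕ-injective; toℕ-fromℕ<; fromℕ<-toℕ; toℕ-fromℕ; toℕ-inject₁; toℕ<n)
open import Data.Fin.Subset using (Subset)
import Data.Fin.Subset as Subset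
open import Data.Nat using (ℕ; zero; suc; _+_; _*_; _∸_; _⊓_; _≤_; _<_; _>_; _<?_; _≟_; z≤n; s≤s; >-nonZero)
open import Data.Nat.Properties
  using ( *-distribʳ-+; *-monoˡ-<; *-monoˡ-≤; +-cancelʳ-≤; +-cancelˡ-≤; +-comm; +-commutativeSemigroup
        ; +-distribʳ-⊓; +-identityʳ; +-mono-≤; +-monoʳ-≤; +-monoˡ-≤; <-cmp; <-irrefl; <⇒≱
        ; m+[n∸m]≡n; m∸n+n≡m; m≤m+n; m≤n+o⇒m∸n≤o; m≤n⇒m<n∨m≡n; m≤n⇒m⊓n≡m; m⊓n≤m; ⊓-glb; ⊓-zeroʳ
        ; ≤-antisym; ≤-pred; ≤-refl; ≤-reflexive; ≤-trans; ≤∧≢⇒<; ≮⇒≥; module ≤-Reasoning )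
import Data.Nat.Properties as ℕ
open import Algebra.Properties.CommutativeSemigroup +-commutativeSemigroup using (interchange; xy∙z≈xz∙y)
open import Data.Nat.Tactic.RingSolver using (solve-∀)
open import Data.Product using (∃-syntax; _×_; _,_; proj₁; proj₂)
open import Data.Sum using (_⊎_; inj₁; inj₂)
open import Data.Vec using (tabulate)
open import Data.Vec.Properties using (lookup∘tabulate; []=⇒lookup)
open import Function using (_∘_; flip)
open import Relation.Binary.Definitions using (Tri; tri<; tri≈; tri>)
open import Relation.Binary.PropositionalEquality
  using (_≡_; _≢_; refl; sym; trans; cong; cong₂; subst; module ≡-Reasoning)
open import Relation.Nullary using (¬_; Dec; yes; no)
open import Relation.Nullary.Decidable using (⌊_⌋)

-- Finite sets as Boolean predicates

private variable n n′ : ℕ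

Subsetᵇ : ℕ → Set
Subsetᵇ n = Fin n → Bool

infix 4 _∈_ _∉_ _⊆_
infixr 7 _∩_
infixr 6 _∪_ _─_

record _∈_ (x : Fin n) (p : Subsetᵇ n) : Set where
  constructor mk∈
  field true⇐∈ : p x ≡ true

open _∈_ public

_∉_ : Fin n → Subsetᵇ n → Set
x ∉ p = ¬ x ∈ p

_⊆_ : Subsetᵇ n → Subsetᵇ n → Set
p ⊆ q = ∀ {x} → x ∈ p → x ∈ q

∅ ⊤ : Subsetᵇ n
∅ _ = false
⊤ _ = true

∁ : Subsetᵇ n → Subsetᵇ n
∁ p x = not (p x)

_∪_ _∩_ _─_ : Subsetᵇ n → Subsetᵇ n → Subsetᵇ n
(p ∪ q) x = p x ∨ q x
(p ∩ q) x = p x ∧ q x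
(p ─ q) x = p x ∧ not (q x)

module _ {p : Subsetᵇ n} {x : Fin n} where

  false⇐∉ : x ∉ p → p x ≡ false
  false⇐∉ x∉p with p x in eq
  ... | true = ⊥-elim (x∉p (mk∈ eq))
  ... | false = refl

  ∉⇐false : p x ≡ false → x ∉ p
  ∉⇐false x∉p (mk∈ x∈p) with () ← trans (sym x∉p) x∈p

  ∈⊎∉ : x ∈ p ⊎ x ∉ p
  ∈⊎∉ with p x in eq
  ... | true = inj₁ (mk∈ eq)
  ... | false = inj₂ (∉⇐false eq)

  ∈∁⁺ : x ∉ p → x ∈ ∁ p
  ∈∁⁺ x∉p = mk∈ (cong not (false⇐∉ x∉p))

  ∈∁⁻ : x ∈ ∁ p → x ∉ p
  ∈∁⁻ (mk∈ x∈∁p) (mk∈ x∈p) rewrite x∈p with () ← x∈∁p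

module _ {p q : Subsetᵇ n} {x : Fin n} where

  ∈∪⁺ˡ : x ∈ p → x ∈ p ∪ q
  ∈∪⁺ˡ (mk∈ x∈p) = mk∈ (cong (_∨ q x) x∈p)

  ∈∪⁺ʳ : x ∈ q → x ∈ p ∪ q
  ∈∪⁺ʳ (mk∈ x∈q) = mk∈ (trans (cong (p x ∨_) x∈q) (∨-zeroʳ (p x)))

  ∈∪⁻ : x ∈ p ∪ q → x ∈ p ⊎ x ∈ q
  ∈∪⁻ (mk∈ x∈p∪q) with p x in eq
  ... | true = inj₁ (mk∈ eq)
  ... | false = inj₂ (mk∈ x∈p∪q)

  ∈∩⁺ : x ∈ p → x ∈ q → x ∈ p ∩ q
  ∈∩⁺ (mk∈ x∈p) (mk∈ x∈q) = mk∈ (cong₂ _∧_ x∈p x∈q)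

  ∈∩⁻ : x ∈ p ∩ q → x ∈ p × x ∈ q
  ∈∩⁻ (mk∈ x∈p∩q) = mk∈ (∧-conicalˡ _ _ x∈p∩q) , mk∈ (∧-conicalʳ _ _ x∈p∩q)

  ∈─⁺ : x ∈ p → x ∉ q → x ∈ p ─ q
  ∈─⁺ (mk∈ x∈p) x∉q = mk∈ (cong₂ _∧_ x∈p (cong not (false⇐∉ x∉q)))

  ∈─⁻ : x ∈ p ─ q → x ∈ p × x ∉ q
  ∈─⁻ (mk∈ x∈p─q) = mk∈ (∧-conicalˡ _ _ x∈p─q) , ∉⇐false (not-injective (∧-conicalʳ (p x) _ x∈p─q))

private
  bit : Bool → ℕ
  bit true = 1
  bit false = 0

∣_∣ : Subsetᵇ n → ℕ
∣_∣ {zero} p = 0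
∣_∣ {suc n} p = bit (p zero) + ∣ p ∘ suc ∣

private
  ∣∣-additive : ∀ (p q r s : Subsetᵇ n) → (∀ x → bit (p x) + bit (q x) ≡ bit (r x) + bit (s x)) →
                ∣ p ∣ + ∣ q ∣ ≡ ∣ r ∣ + ∣ s ∣
  ∣∣-additive {zero} _ _ _ _ _ = refl
  ∣∣-additive {suc n} p q r s h = begin
    (bit (p zero) + ∣ p ∘ suc ∣) + (bit (q zero) + ∣ q ∘ suc ∣)
      ≡⟨ interchange (bit (p zero)) _ _ _ ⟩
    (bit (p zero) + bit (q zero)) + (∣ p ∘ suc ∣ + ∣ q ∘ suc ∣)
      ≡⟨ cong₂ _+_ (h zero) (∣∣-additive (p ∘ suc) (q ∘ suc) (r ∘ suc) (s ∘ suc) (h ∘ suc)) ⟩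
    (bit (r zero) + bit (s zero)) + (∣ r ∘ suc ∣ + ∣ s ∘ suc ∣)
      ≡⟨ interchange (bit (r zero)) _ _ _ ⟩
    (bit (r zero) + ∣ r ∘ suc ∣) + (bit (s zero) + ∣ s ∘ suc ∣) ∎
    where open ≡-Reasoning

  ∣∣-subadditive : ∀ (p q r s : Subsetᵇ n) → (∀ x → bit (p x) + bit (q x) ≤ bit (r x) + bit (s x)) →
                   ∣ p ∣ + ∣ q ∣ ≤ ∣ r ∣ + ∣ s ∣
  ∣∣-subadditive {zero} _ _ _ _ _ = z≤n
  ∣∣-subadditive {suc n} p q r s h = begin
    (bit (p zero) + ∣ p ∘ suc ∣) + (bit (q zero) + ∣ q ∘ suc ∣)
      ≡⟨ interchange (bit (p zero)) _ _ _ ⟩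
    (bit (p zero) + bit (q zero)) + (∣ p ∘ suc ∣ + ∣ q ∘ suc ∣)
      ≤⟨ +-mono-≤ (h zero) (∣∣-subadditive (p ∘ suc) (q ∘ suc) (r ∘ suc) (s ∘ suc) (h ∘ suc)) ⟩
    (bit (r zero) + bit (s zero)) + (∣ r ∘ suc ∣ + ∣ s ∘ suc ∣)
      ≡⟨ interchange (bit (r zero)) _ _ _ ⟩
    (bit (r zero) + ∣ r ∘ suc ∣) + (bit (s zero) + ∣ s ∘ suc ∣) ∎
    where open ≤-Reasoning

∣∅∣≡0 : ∣ ∅ {n} ∣ ≡ 0
∣∅∣≡0 {zero} = refl
∣∅∣≡0 {suc n} = ∣∅∣≡0 {n}

∣⊤∣≡n : ∣ ⊤ {n} ∣ ≡ n
∣⊤∣≡n {zero} = refl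
∣⊤∣≡n {suc n} = cong suc (∣⊤∣≡n {n})

∣∣-cong : ∀ {p q : Subsetᵇ n} → (∀ x → p x ≡ q x) → ∣ p ∣ ≡ ∣ q ∣
∣∣-cong {zero} h = refl
∣∣-cong {suc n} h = cong₂ _+_ (cong bit (h zero)) (∣∣-cong (h ∘ suc))

private
  bit-mono : ∀ {a b} → (a ≡ true → b ≡ true) → bit a ≤ bit b
  bit-mono {true} a⇒b rewrite a⇒b refl = ≤-refl
  bit-mono {false} _ = z≤n

  ∣p∣+∣∅∣≡∣p∣ : (p : Subsetᵇ n) → ∣ p ∣ + ∣ ∅ {n} ∣ ≡ ∣ p ∣
  ∣p∣+∣∅∣≡∣p∣ {n} p = trans (cong (∣ p ∣ +_) (∣∅∣≡0 {n})) (+-identityʳ ∣ p ∣)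

p⊆q⇒∣p∣≤∣q∣ : ∀ {p q : Subsetᵇ n} → p ⊆ q → ∣ p ∣ ≤ ∣ q ∣
p⊆q⇒∣p∣≤∣q∣ {zero} _ = z≤n
p⊆q⇒∣p∣≤∣q∣ {suc n} {p} {q} p⊆q = +-mono-≤ (bit-mono (true⇐∈ ∘ p⊆q ∘ mk∈))
  (p⊆q⇒∣p∣≤∣q∣ {p = p ∘ suc} {q ∘ suc} (mk∈ ∘ true⇐∈ ∘ p⊆q ∘ mk∈ ∘ true⇐∈))

∣p∪q∣≤∣p∣+∣q∣ : (p q : Subsetᵇ n) → ∣ p ∪ q ∣ ≤ ∣ p ∣ + ∣ q ∣
∣p∪q∣≤∣p∣+∣q∣ p q =
  subst (_≤ ∣ p ∣ + ∣ q ∣) (∣p∣+∣∅∣≡∣p∣ (p ∪ q)) (∣∣-subadditive (p ∪ q) ∅ p q λ x → bound (p x) (q x))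
  where
  bound : ∀ a b → bit (a ∨ b) + 0 ≤ bit a + bit b
  bound true b = s≤s z≤n
  bound false b = ≤-reflexive (+-identityʳ (bit b))

∣p∪q∣≡∣p∣+∣q∣ : (p q : Subsetᵇ n) → (∀ {x} → x ∈ p → x ∉ q) → ∣ p ∪ q ∣ ≡ ∣ p ∣ + ∣ q ∣
∣p∪q∣≡∣p∣+∣q∣ p q disjoint = trans (sym (∣p∣+∣∅∣≡∣p∣ (p ∪ q)))
  (∣∣-additive (p ∪ q) ∅ p q λ x → count (p x) (q x) (false⇐∉ ∘ disjoint ∘ mk∈))
  where
  count : ∀ a b → (a ≡ true → b ≡ false) → bit (a ∨ b) + 0 ≡ bit a + bit b
  count true b a⇒¬b rewrite a⇒¬b refl = refl
  count false b _ = +-identityʳ (bit b)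

∣p∩q∣+∣p─q∣≡∣p∣ : (p q : Subsetᵇ n) → ∣ p ∩ q ∣ + ∣ p ─ q ∣ ≡ ∣ p ∣
∣p∩q∣+∣p─q∣≡∣p∣ p q = trans (∣∣-additive (p ∩ q) (p ─ q) p ∅ λ x → count (p x) (q x)) (∣p∣+∣∅∣≡∣p∣ p)
  where
  count : ∀ a b → bit (a ∧ b) + bit (a ∧ not b) ≡ bit a + 0
  count true true = refl
  count true false = refl
  count false b = refl

∣p∣+∣∁p∣≡n : (p : Subsetᵇ n) → ∣ p ∣ + ∣ ∁ p ∣ ≡ n
∣p∣+∣∁p∣≡n {n} p = trans (∣∣-additive p (∁ p) ⊤ ∅ λ x → count (p x)) (trans (∣p∣+∣∅∣≡∣p∣ (⊤ {n})) (∣⊤∣≡n {n}))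
  where
  count : ∀ a → bit a + bit (not a) ≡ 1 + 0
  count true = refl
  count false = refl

∣p─q∣+∣q∣≡∣p∣ : (p q : Subsetᵇ n) → q ⊆ p → ∣ p ─ q ∣ + ∣ q ∣ ≡ ∣ p ∣
∣p─q∣+∣q∣≡∣p∣ p q q⊆p =
  trans (∣∣-additive (p ─ q) q p ∅ λ x → count (p x) (q x) (true⇐∈ ∘ q⊆p ∘ mk∈)) (∣p∣+∣∅∣≡∣p∣ p)
  where
  count : ∀ a b → (b ≡ true → a ≡ true) → bit (a ∧ not b) + bit b ≡ bit a + 0
  count a true b⇒a rewrite b⇒a refl = refl
  count true false _ = refl
  count false false _ = refl

∣p∣≤1 : (p : Subsetᵇ n) → (∀ {x y} → x ∈ p → y ∈ p → x ≡ y) → ∣ p ∣ ≤ 1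
∣p∣≤1 {zero} p _ = z≤n
∣p∣≤1 {suc n} p unique with p zero in p₀
... | false = ∣p∣≤1 (p ∘ suc) λ x∈p y∈p → suc-injective (unique (mk∈ (true⇐∈ x∈p)) (mk∈ (true⇐∈ y∈p)))
... | true = s≤s (≤-reflexive (trans (∣∣-cong {q = ∅} only-zero) (∣∅∣≡0 {n})))
  where
  only-zero : ∀ x → p (suc x) ≡ false
  only-zero x = false⇐∉ λ x∈p → 0≢1+n (unique (mk∈ p₀) x∈p)

take : ℕ → Subsetᵇ n → Subsetᵇ n
take zero p = ∅
take (suc r) p zero = p zero
take (suc r) p (suc x) = take (if p zero then r else suc r) (p ∘ suc) x

take⊆ : ∀ r (p : Subsetᵇ n) → take r p ⊆ p
take⊆ (suc r) p {zero} x∈ = mk∈ (true⇐∈ x∈)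
take⊆ (suc r) p {suc x} x∈ = mk∈ (true⇐∈ (take⊆ (if p zero then r else suc r) (p ∘ suc) (mk∈ (true⇐∈ x∈))))

∣take∣ : ∀ r (p : Subsetᵇ n) → ∣ take r p ∣ ≡ r ⊓ ∣ p ∣
∣take∣ {zero} r p = sym (⊓-zeroʳ r)
∣take∣ {suc n} zero p = ∣∅∣≡0 {suc n}
∣take∣ {suc n} (suc r) p with p zero
... | true = cong suc (∣take∣ r (p ∘ suc))
... | false = ∣take∣ (suc r) (p ∘ suc)

private
  room-outside : (T F : Subsetᵇ n) {g : ℕ} → g + ∣ F ∣ ≤ n → g ∸ ∣ T ∣ ≤ ∣ ∁ (T ∪ F) ∣
  room-outside {n} T F {g} room = m≤n+o⇒m∸n≤o g ∣ T ∣ (+-cancelʳ-≤ ∣ F ∣ g (∣ T ∣ + ∣ free ∣) (begin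
    g + ∣ F ∣                  ≤⟨ room ⟩
    n                          ≡⟨ sym (∣p∣+∣∁p∣≡n (T ∪ F)) ⟩
    ∣ T ∪ F ∣ + ∣ free ∣       ≤⟨ +-monoˡ-≤ ∣ free ∣ (∣p∪q∣≤∣p∣+∣q∣ T F) ⟩
    ∣ T ∣ + ∣ F ∣ + ∣ free ∣   ≡⟨ xy∙z≈xz∙y (∣ T ∣) (∣ F ∣) (∣ free ∣) ⟩
    ∣ T ∣ + ∣ free ∣ + ∣ F ∣   ∎))
    where
    open ≤-Reasoning
    free = ∁ (T ∪ F)

extendTo : ℕ → Subsetᵇ n → Subsetᵇ n → Subsetᵇ n
extendTo g T F = T ∪ take (g ∸ ∣ T ∣) (∁ (T ∪ F))

module _ {g : ℕ} {T F : Subsetᵇ n} where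

  ⊆extendTo : T ⊆ extendTo g T F
  ⊆extendTo = ∈∪⁺ˡ

  extendTo-avoids : ∀ {x} → x ∈ extendTo g T F → x ∈ F → x ∈ T
  extendTo-avoids x∈ x∈F with ∈∪⁻ x∈
  ... | inj₁ x∈T = x∈T
  ... | inj₂ x∈new = ⊥-elim (∈∁⁻ (take⊆ (g ∸ ∣ T ∣) _ x∈new) (∈∪⁺ʳ x∈F))

  ∣extendTo∣ : ∣ T ∣ ≤ g → g + ∣ F ∣ ≤ n → ∣ extendTo g T F ∣ ≡ g
  ∣extendTo∣ ∣T∣≤g room = begin
    ∣ extendTo g T F ∣                  ≡⟨ ∣p∪q∣≡∣p∣+∣q∣ T new disjoint ⟩
    ∣ T ∣ + ∣ new ∣                     ≡⟨ cong (∣ T ∣ +_) (∣take∣ (g ∸ ∣ T ∣) free) ⟩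
    ∣ T ∣ + (g ∸ ∣ T ∣) ⊓ ∣ free ∣      ≡⟨ cong (∣ T ∣ +_) (m≤n⇒m⊓n≡m (room-outside T F room)) ⟩
    ∣ T ∣ + (g ∸ ∣ T ∣)                 ≡⟨ m+[n∸m]≡n ∣T∣≤g ⟩
    g                                   ∎
    where
    open ≡-Reasoning
    free new : Subsetᵇ n
    free = ∁ (T ∪ F)
    new = take (g ∸ ∣ T ∣) free
    disjoint : ∀ {x} → x ∈ T → x ∉ new
    disjoint x∈T x∈new = ∈∁⁻ (take⊆ (g ∸ ∣ T ∣) free x∈new) (∈∪⁺ˡ x∈T)

Functional : (Fin n → Fin n′ → Bool) → Set
Functional R = ∀ {x y y′} → R x y ≡ true → R x y′ ≡ true → y ≡ y′

private
  any : Subsetᵇ n → Bool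
  any {zero} p = false
  any {suc n} p = p zero ∨ any (p ∘ suc)

image : (Fin n → Fin n′ → Bool) → Subsetᵇ n → Subsetᵇ n′
image R X y = any λ x → X x ∧ R x y

∈image⁺ : ∀ {R : Fin n → Fin n′ → Bool} {X x y} → x ∈ X → R x y ≡ true → y ∈ image R X
∈image⁺ {R = R} {X} {zero} {y} (mk∈ x∈X) Rxy =
  mk∈ (cong (_∨ image (R ∘ suc) (X ∘ suc) y) (cong₂ _∧_ x∈X Rxy))
∈image⁺ {R = R} {X} {suc x} {y} x∈X Rxy =
  ∈∪⁺ʳ {p = λ y → X zero ∧ R zero y} (∈image⁺ {R = R ∘ suc} {X = X ∘ suc} (mk∈ (true⇐∈ x∈X)) Rxy)

∈image⁻ : ∀ {R : Fin n → Fin n′ → Bool} {X y} → y ∈ image R X → ∃[ x ] x ∈ X × R x y ≡ true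
∈image⁻ {zero} (mk∈ ())
∈image⁻ {suc n} {R = R} {X} {y} y∈ with ∈∪⁻ {p = λ y → X zero ∧ R zero y} {q = image (R ∘ suc) (X ∘ suc)} y∈
... | inj₁ (mk∈ head) with X zero in eX | R zero y in eR
...   | true | true = zero , mk∈ eX , eR
∈image⁻ {suc n} {R = R} {X} {y} y∈ | inj₂ later with ∈image⁻ {R = R ∘ suc} {X ∘ suc} later
... | x , x∈X , Rxy = suc x , mk∈ (true⇐∈ x∈X) , Rxy

∣image∣≤∣X∣ : ∀ {R : Fin n → Fin n′ → Bool} → Functional R → (X : Subsetᵇ n) → ∣ image R X ∣ ≤ ∣ X ∣
∣image∣≤∣X∣ {zero} {n′} _ X = ≤-reflexive (∣∅∣≡0 {n′})
∣image∣≤∣X∣ {suc n} {n′} {R} functional X = begin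
  ∣ image R X ∣                                          ≤⟨ ∣p∪q∣≤∣p∣+∣q∣ (from zero) rest ⟩
  ∣ from zero ∣ + ∣ rest ∣                                ≤⟨ +-mono-≤ (∣from∣ (X zero)) rest-bound ⟩
  bit (X zero) + ∣ X ∘ suc ∣                             ∎
  where
  open ≤-Reasoning
  from : Fin (suc n) → Subsetᵇ n′
  from x y = X x ∧ R x y
  rest : Subsetᵇ n′
  rest = image (R ∘ suc) (X ∘ suc)
  rest-bound : ∣ rest ∣ ≤ ∣ X ∘ suc ∣
  rest-bound = ∣image∣≤∣X∣ {R = R ∘ suc} functional (X ∘ suc)
  ∣from∣ : ∀ b → ∣ (λ y → b ∧ R zero y) ∣ ≤ bit b
  ∣from∣ true = ∣p∣≤1 (R zero) λ y∈ y′∈ → functional (true⇐∈ y∈) (true⇐∈ y′∈)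
  ∣from∣ false = ≤-reflexive (∣∅∣≡0 {n′})

∉∅ : ∀ {x : Fin n} → x ∉ ∅
∉∅ (mk∈ ())

toSubset : Subsetᵇ n → Subset n
toSubset = tabulate

∈toSubset⁻ : ∀ {p : Subsetᵇ n} {x} → x Subset.∈ toSubset p → x ∈ p
∈toSubset⁻ {p = p} {x} x∈ = mk∈ (trans (sym (lookup∘tabulate p x)) ([]=⇒lookup x∈))

∣toSubset∣ : (p : Subsetᵇ n) → Subset.∣ toSubset p ∣ ≡ ∣ p ∣
∣toSubset∣ {zero} p = refl
∣toSubset∣ {suc n} p with p zero
... | true = cong suc (∣toSubset∣ (p ∘ suc))
... | false = ∣toSubset∣ (p ∘ suc)

-- Reserving overlap between two matchings

record IsMatching {n n′ : ℕ} (R : Fin n → Fin n′ → Bool) : Set where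
  field
    functional : Functional R
    injective  : Functional (flip R)

-- Lists Lₗ and Lᵣ are matched into a middle list of size n. Avoiding Xₗ and Xᵣ, reserve at most m
-- vertices on each side so that any Sₗ ⊇ Pₗ and Sᵣ ⊇ Pᵣ hit at most ∣ Sₗ ∣ + ∣ Sᵣ ∣ ∸ m middle
-- colours: every colour hit from Pₗ is hit again from its partner in Pᵣ, and the spare vertices of
-- Pᵣ hit nothing.
module Overlap {nₗ nᵣ n : ℕ} (m : ℕ)
  {Eₗ : Fin nₗ → Fin n → Bool} {Eᵣ : Fin nᵣ → Fin n → Bool}
  (Eₗ-matching : IsMatching Eₗ) (Eᵣ-matching : IsMatching Eᵣ)
  (Xₗ : Subsetᵇ nₗ) (Xᵣ : Subsetᵇ nᵣ) where

  private
    module Mₗ = IsMatching Eₗ-matching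
    module Mᵣ = IsMatching Eᵣ-matching

  reached : Subsetᵇ n
  reached = image Eᵣ (∁ Xᵣ)

  stray : Subsetᵇ nₗ
  stray = image (flip Eₗ) (∁ reached)

  goodₗ : Subsetᵇ nₗ
  goodₗ = ∁ Xₗ ─ stray

  matchedᵣ : Subsetᵇ nᵣ
  matchedᵣ = image (flip Eᵣ) ⊤

  unmatchedᵣ : Subsetᵇ nᵣ
  unmatchedᵣ = ∁ Xᵣ ─ matchedᵣ

  Pₗ : Subsetᵇ nₗ
  Pₗ = take m goodₗ

  spareᵣ : Subsetᵇ nᵣ
  spareᵣ = take (m ∸ ∣ Pₗ ∣) unmatchedᵣ

  partnersᵣ : Subsetᵇ nᵣ
  partnersᵣ = ∁ Xᵣ ∩ image (flip Eᵣ) (image Eₗ Pₗ)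

  Pᵣ : Subsetᵇ nᵣ
  Pᵣ = spareᵣ ∪ partnersᵣ

  Pₗ-avoids : ∀ {a} → a ∈ Pₗ → a ∉ Xₗ
  Pₗ-avoids a∈ = ∈∁⁻ (proj₁ (∈─⁻ (take⊆ m goodₗ a∈)))

  Pᵣ-avoids : ∀ {d} → d ∈ Pᵣ → d ∉ Xᵣ
  Pᵣ-avoids d∈ with ∈∪⁻ d∈
  ... | inj₁ spare = ∈∁⁻ (proj₁ (∈─⁻ (take⊆ (m ∸ ∣ Pₗ ∣) unmatchedᵣ spare)))
  ... | inj₂ partner = ∈∁⁻ (proj₁ (∈∩⁻ partner))

  ∣Pₗ∣≤m : ∣ Pₗ ∣ ≤ m
  ∣Pₗ∣≤m = ≤-trans (≤-reflexive (∣take∣ m goodₗ)) (m⊓n≤m m _)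

  ∣Pᵣ∣≤m : ∣ Pᵣ ∣ ≤ m
  ∣Pᵣ∣≤m = begin
    ∣ Pᵣ ∣                          ≤⟨ ∣p∪q∣≤∣p∣+∣q∣ spareᵣ partnersᵣ ⟩
    ∣ spareᵣ ∣ + ∣ partnersᵣ ∣      ≤⟨ +-mono-≤ ∣spare∣≤ ∣partners∣≤ ⟩
    m ∸ ∣ Pₗ ∣ + ∣ Pₗ ∣             ≡⟨ m∸n+n≡m ∣Pₗ∣≤m ⟩
    m                               ∎
    where
    open ≤-Reasoning
    ∣spare∣≤ : ∣ spareᵣ ∣ ≤ m ∸ ∣ Pₗ ∣
    ∣spare∣≤ = ≤-trans (≤-reflexive (∣take∣ (m ∸ ∣ Pₗ ∣) unmatchedᵣ)) (m⊓n≤m _ _)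
    ∣partners∣≤ : ∣ partnersᵣ ∣ ≤ ∣ Pₗ ∣
    ∣partners∣≤ = begin
      ∣ partnersᵣ ∣                              ≤⟨ p⊆q⇒∣p∣≤∣q∣ {p = partnersᵣ} (proj₂ ∘ ∈∩⁻ {p = ∁ Xᵣ}) ⟩
      ∣ image (flip Eᵣ) (image Eₗ Pₗ) ∣          ≤⟨ ∣image∣≤∣X∣ Mᵣ.injective (image Eₗ Pₗ) ⟩
      ∣ image Eₗ Pₗ ∣                            ≤⟨ ∣image∣≤∣X∣ Mₗ.functional Pₗ ⟩
      ∣ Pₗ ∣                                     ∎

  private
    matched⇒¬spare : ∀ {d c} → Eᵣ d c ≡ true → d ∉ spareᵣ
    matched⇒¬spare Edc d∈spare =
      proj₂ (∈─⁻ (take⊆ (m ∸ ∣ Pₗ ∣) unmatchedᵣ d∈spare)) (∈image⁺ {R = flip Eᵣ} {X = ⊤} (mk∈ refl) Edc)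

    reserved⇒reached : ∀ {a c} → a ∈ Pₗ → Eₗ a c ≡ true → c ∈ reached
    reserved⇒reached {a} {c} a∈P Eac with ∈⊎∉ {p = reached} {x = c}
    ... | inj₁ c∈reached = c∈reached
    ... | inj₂ c∉reached = ⊥-elim (proj₂ (∈─⁻ (take⊆ m goodₗ a∈P)) (∈image⁺ {R = flip Eₗ} (∈∁⁺ c∉reached) Eac))

  module _ (room : ∣ Xₗ ∣ + ∣ Xᵣ ∣ + (n + m) ≤ nₗ + nᵣ) where

    m≤∣goodₗ∣+∣unmatchedᵣ∣ : m ≤ ∣ goodₗ ∣ + ∣ unmatchedᵣ ∣
    m≤∣goodₗ∣+∣unmatchedᵣ∣ = +-cancelˡ-≤ n m (G + U) (+-cancelˡ-≤ (∣ Xₗ ∣ + ∣ Xᵣ ∣) _ _ (begin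
      ∣ Xₗ ∣ + ∣ Xᵣ ∣ + (n + m)              ≤⟨ room ⟩
      nₗ + nᵣ                                ≡⟨ sym (cong₂ _+_ splitₗ splitᵣ) ⟩
      ∣ Xₗ ∣ + (B + G) + (∣ Xᵣ ∣ + (M + U))   ≡⟨ interchange (∣ Xₗ ∣) (B + G) (∣ Xᵣ ∣) (M + U) ⟩
      ∣ Xₗ ∣ + ∣ Xᵣ ∣ + (B + G + (M + U))     ≡⟨ cong (∣ Xₗ ∣ + ∣ Xᵣ ∣ +_) (interchange B G M U) ⟩
      ∣ Xₗ ∣ + ∣ Xᵣ ∣ + (B + M + (G + U))     ≤⟨ +-monoʳ-≤ (∣ Xₗ ∣ + ∣ Xᵣ ∣) (+-monoˡ-≤ (G + U) B+M≤n) ⟩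
      ∣ Xₗ ∣ + ∣ Xᵣ ∣ + (n + (G + U))         ∎))
      where
      open ≤-Reasoning
      B G M U : ℕ
      B = ∣ ∁ Xₗ ∩ stray ∣
      G = ∣ goodₗ ∣
      M = ∣ ∁ Xᵣ ∩ matchedᵣ ∣
      U = ∣ unmatchedᵣ ∣
      splitₗ : ∣ Xₗ ∣ + (B + G) ≡ nₗ
      splitₗ = trans (cong (∣ Xₗ ∣ +_) (∣p∩q∣+∣p─q∣≡∣p∣ (∁ Xₗ) stray)) (∣p∣+∣∁p∣≡n Xₗ)
      splitᵣ : ∣ Xᵣ ∣ + (M + U) ≡ nᵣ
      splitᵣ = trans (cong (∣ Xᵣ ∣ +_) (∣p∩q∣+∣p─q∣≡∣p∣ (∁ Xᵣ) matchedᵣ)) (∣p∣+∣∁p∣≡n Xᵣ)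
      matched⊆ : ∁ Xᵣ ∩ matchedᵣ ⊆ image (flip Eᵣ) reached
      matched⊆ d∈ with ∈∩⁻ d∈
      ... | available , matched with ∈image⁻ {R = flip Eᵣ} matched
      ...   | c , _ , Edc = ∈image⁺ {R = flip Eᵣ} (∈image⁺ {R = Eᵣ} available Edc) Edc
      B+M≤n : B + M ≤ n
      B+M≤n = begin
        B + M                    ≤⟨ +-mono-≤ (p⊆q⇒∣p∣≤∣q∣ {p = ∁ Xₗ ∩ stray} (proj₂ ∘ ∈∩⁻ {p = ∁ Xₗ}))
                                             (p⊆q⇒∣p∣≤∣q∣ {p = ∁ Xᵣ ∩ matchedᵣ} matched⊆) ⟩
        ∣ stray ∣ + ∣ image (flip Eᵣ) reached ∣
          ≤⟨ +-mono-≤ (∣image∣≤∣X∣ Mₗ.injective (∁ reached)) (∣image∣≤∣X∣ Mᵣ.injective reached) ⟩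
        ∣ ∁ reached ∣ + ∣ reached ∣ ≡⟨ +-comm (∣ ∁ reached ∣) (∣ reached ∣) ⟩
        ∣ reached ∣ + ∣ ∁ reached ∣ ≡⟨ ∣p∣+∣∁p∣≡n reached ⟩
        n                        ∎

    ∣spareᵣ∣ : ∣ spareᵣ ∣ ≡ m ∸ ∣ Pₗ ∣
    ∣spareᵣ∣ = trans (∣take∣ (m ∸ ∣ Pₗ ∣) unmatchedᵣ) (m≤n⇒m⊓n≡m (m≤n+o⇒m∸n≤o m ∣ Pₗ ∣ m≤∣Pₗ∣+U))
      where
      m≤∣Pₗ∣+U : m ≤ ∣ Pₗ ∣ + ∣ unmatchedᵣ ∣
      m≤∣Pₗ∣+U = begin
        m                                                  ≤⟨ ⊓-glb (m≤m+n m _) m≤∣goodₗ∣+∣unmatchedᵣ∣ ⟩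
        (m + ∣ unmatchedᵣ ∣) ⊓ (∣ goodₗ ∣ + ∣ unmatchedᵣ ∣)
          ≡⟨ sym (+-distribʳ-⊓ (∣ unmatchedᵣ ∣) m (∣ goodₗ ∣)) ⟩
        m ⊓ ∣ goodₗ ∣ + ∣ unmatchedᵣ ∣                     ≡⟨ cong (_+ ∣ unmatchedᵣ ∣) (sym (∣take∣ m goodₗ)) ⟩
        ∣ Pₗ ∣ + ∣ unmatchedᵣ ∣                            ∎
        where open ≤-Reasoning

    ∣image∪image∣+m≤∣Sₗ∣+∣Sᵣ∣ : ∀ {Sₗ Sᵣ} → Pₗ ⊆ Sₗ → Pᵣ ⊆ Sᵣ →
                              ∣ image Eₗ Sₗ ∪ image Eᵣ Sᵣ ∣ + m ≤ ∣ Sₗ ∣ + ∣ Sᵣ ∣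
    ∣image∪image∣+m≤∣Sₗ∣+∣Sᵣ∣ {Sₗ} {Sᵣ} Pₗ⊆Sₗ Pᵣ⊆Sᵣ = begin
      ∣ image Eₗ Sₗ ∪ image Eᵣ Sᵣ ∣ + m
        ≤⟨ +-monoˡ-≤ m (≤-trans (p⊆q⇒∣p∣≤∣q∣ {p = image Eₗ Sₗ ∪ image Eᵣ Sᵣ} covered)
                                (∣p∪q∣≤∣p∣+∣q∣ (image Eₗ Sₗ′) (image Eᵣ Sᵣ′))) ⟩
      ∣ image Eₗ Sₗ′ ∣ + ∣ image Eᵣ Sᵣ′ ∣ + m
        ≤⟨ +-monoˡ-≤ m (+-mono-≤ (∣image∣≤∣X∣ Mₗ.functional Sₗ′) (∣image∣≤∣X∣ Mᵣ.functional Sᵣ′)) ⟩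
      ∣ Sₗ′ ∣ + ∣ Sᵣ′ ∣ + m
        ≡⟨ cong (∣ Sₗ′ ∣ + ∣ Sᵣ′ ∣ +_) (sym (m+[n∸m]≡n ∣Pₗ∣≤m)) ⟩
      ∣ Sₗ′ ∣ + ∣ Sᵣ′ ∣ + (∣ Pₗ ∣ + (m ∸ ∣ Pₗ ∣))
        ≡⟨ interchange (∣ Sₗ′ ∣) (∣ Sᵣ′ ∣) (∣ Pₗ ∣) (m ∸ ∣ Pₗ ∣) ⟩
      ∣ Sₗ′ ∣ + ∣ Pₗ ∣ + (∣ Sᵣ′ ∣ + (m ∸ ∣ Pₗ ∣))
        ≡⟨ cong₂ _+_ (∣p─q∣+∣q∣≡∣p∣ Sₗ Pₗ Pₗ⊆Sₗ)
                     (trans (cong (∣ Sᵣ′ ∣ +_) (sym ∣spareᵣ∣)) (∣p─q∣+∣q∣≡∣p∣ Sᵣ spareᵣ (Pᵣ⊆Sᵣ ∘ ∈∪⁺ˡ))) ⟩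
      ∣ Sₗ ∣ + ∣ Sᵣ ∣ ∎
      where
      open ≤-Reasoning
      Sₗ′ : Subsetᵇ nₗ
      Sₗ′ = Sₗ ─ Pₗ
      Sᵣ′ : Subsetᵇ nᵣ
      Sᵣ′ = Sᵣ ─ spareᵣ
      fromᵣ : ∀ {d c} → d ∈ Sᵣ → Eᵣ d c ≡ true → c ∈ image Eᵣ Sᵣ′
      fromᵣ d∈S Edc = ∈image⁺ {R = Eᵣ} {X = Sᵣ′} (∈─⁺ d∈S (matched⇒¬spare Edc)) Edc
      covered : image Eₗ Sₗ ∪ image Eᵣ Sᵣ ⊆ image Eₗ Sₗ′ ∪ image Eᵣ Sᵣ′
      covered c∈ with ∈∪⁻ c∈
      ... | inj₂ fromRight with ∈image⁻ fromRight
      ...   | d , d∈S , Edc = ∈∪⁺ʳ (fromᵣ d∈S Edc)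
      covered c∈ | inj₁ fromLeft with ∈image⁻ fromLeft
      ... | a , a∈S , Eac with ∈⊎∉ {p = Pₗ} {x = a}
      ...   | inj₂ a∉P = ∈∪⁺ˡ (∈image⁺ {R = Eₗ} {X = Sₗ′} (∈─⁺ a∈S a∉P) Eac)
      ...   | inj₁ a∈P with ∈image⁻ (reserved⇒reached a∈P Eac)
      ...     | d , d∈avail , Edc = ∈∪⁺ʳ (fromᵣ (Pᵣ⊆Sᵣ (∈∪⁺ʳ partner)) Edc)
        where
        partner : d ∈ partnersᵣ
        partner = ∈∩⁺ d∈avail (∈image⁺ {R = flip Eᵣ} (∈image⁺ a∈P Eac) Edc)

-- Cycles

module Cycle (n : ℕ) where

  V : Set
  V = Fin (suc n)

  opaque
    next : V → V
    next i with suc (toℕ i) <? suc n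
    ... | yes i+1<k = fromℕ< i+1<k
    ... | no _ = zero

  prev : V → V
  prev zero = fromℕ n
  prev (suc i) = inject₁ i

  opaque
    unfolding next
    CycNext-next : ∀ x → CycNext (suc n) x (next x)
    CycNext-next x with suc (toℕ x) <? suc n
    ... | yes x+1<k = inj₁ (sym (toℕ-fromℕ< x+1<k))
    ... | no x+1≮k = inj₂ (≤-antisym (toℕ<n x) (≮⇒≥ x+1≮k) , refl)

  CycNext-prev : ∀ y → CycNext (suc n) (prev y) y
  CycNext-prev zero = inj₂ (cong suc (toℕ-fromℕ n) , refl)
  CycNext-prev (suc i) = inj₁ (cong suc (toℕ-inject₁ i))

  CycNext-functional : ∀ {x y y′} → CycNext (suc n) x y → CycNext (suc n) x y′ → y ≡ y′
  CycNext-functional (inj₁ e) (inj₁ e′) = toℕ-injective (trans (sym e) e′)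
  CycNext-functional {y = y} (inj₁ e) (inj₂ (e′ , _)) = ⊥-elim (<-irrefl (trans (sym e) e′) (toℕ<n y))
  CycNext-functional {y′ = y′} (inj₂ (e , _)) (inj₁ e′) = ⊥-elim (<-irrefl (trans (sym e′) e) (toℕ<n y′))
  CycNext-functional (inj₂ (_ , e)) (inj₂ (_ , e′)) = toℕ-injective (trans e (sym e′))

  CycNext-injective : ∀ {x x′ y} → CycNext (suc n) x y → CycNext (suc n) x′ y → x ≡ x′
  CycNext-injective (inj₁ e) (inj₁ e′) = toℕ-injective (ℕ.suc-injective (trans e (sym e′)))
  CycNext-injective (inj₁ e) (inj₂ (_ , e′)) with () ← trans e e′
  CycNext-injective (inj₂ (_ , e)) (inj₁ e′) with () ← trans e′ e
  CycNext-injective (inj₂ (e , _)) (inj₂ (e′ , _)) = toℕ-injective (ℕ.suc-injective (trans e (sym e′)))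

  CycNext⇒≡next : ∀ {x y} → CycNext (suc n) x y → y ≡ next x
  CycNext⇒≡next {x} x→y = CycNext-functional x→y (CycNext-next x)

  next-prev : ∀ y → next (prev y) ≡ y
  next-prev y = sym (CycNext⇒≡next (CycNext-prev y))

  prev-next : ∀ x → prev (next x) ≡ x
  prev-next x = CycNext-injective (CycNext-prev (next x)) (CycNext-next x)

  toℕ-next : ∀ x → toℕ (next x) ≡ suc (toℕ x) ⊎ (toℕ x ≡ n × toℕ (next x) ≡ 0)
  toℕ-next x with CycNext-next x
  ... | inj₁ e = inj₁ (sym e)
  ... | inj₂ (e , e′) = inj₂ (ℕ.suc-injective e , e′)

  private
    Step : ℕ → ℕ → Set
    Step a b = b ≡ suc a ⊎ (a ≡ n × b ≡ 0)

    n≢ : ∀ {a b} → suc a ≤ n → b ≤ a → b ≢ n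
    n≢ a<n b≤a b≡n = <-irrefl b≡n (≤-trans (s≤s b≤a) a<n)

    step¹≢ : 1 ≤ n → ∀ {a b} → Step a b → b ≢ a
    step¹≢ _ (inj₁ refl) ()
    step¹≢ 1≤n (inj₂ (refl , refl)) = n≢ 1≤n z≤n

    step²≢ : 2 ≤ n → ∀ {a b c} → Step a b → Step b c → c ≢ a
    step²≢ _ (inj₁ refl) (inj₁ refl) ()
    step²≢ 2≤n (inj₁ refl) (inj₂ (a+1≡n , refl)) refl = n≢ 2≤n (s≤s z≤n) a+1≡n
    step²≢ 2≤n (inj₂ (refl , refl)) (inj₁ refl) = n≢ 2≤n (s≤s z≤n)
    step²≢ 2≤n (inj₂ (refl , refl)) (inj₂ (0≡n , refl)) _ = n≢ 2≤n z≤n 0≡n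

    step³≢ : 3 ≤ n → ∀ {a b c d} → Step a b → Step b c → Step c d → d ≢ a
    step³≢ _ (inj₁ refl) (inj₁ refl) (inj₁ refl) ()
    step³≢ 3≤n (inj₁ refl) (inj₁ refl) (inj₂ (a+2≡n , refl)) refl = n≢ 3≤n ≤-refl a+2≡n
    step³≢ 3≤n (inj₁ refl) (inj₂ (a+1≡n , refl)) (inj₁ refl) refl = n≢ 3≤n (s≤s (s≤s z≤n)) a+1≡n
    step³≢ 3≤n (inj₁ refl) (inj₂ (_ , refl)) (inj₂ (0≡n , refl)) _ = n≢ 3≤n z≤n 0≡n
    step³≢ 3≤n (inj₂ (refl , refl)) (inj₁ refl) (inj₁ refl) = n≢ 3≤n ≤-refl
    step³≢ 3≤n (inj₂ (refl , refl)) (inj₁ refl) (inj₂ (1≡n , refl)) _ = n≢ 3≤n (s≤s z≤n) 1≡n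
    step³≢ 3≤n (inj₂ (refl , refl)) (inj₂ (0≡n , _)) _ _ = n≢ 3≤n z≤n 0≡n

  next≢ : 1 ≤ n → ∀ x → next x ≢ x
  next≢ 1≤n x e = step¹≢ 1≤n (toℕ-next x) (cong toℕ e)

  next²≢ : 2 ≤ n → ∀ x → next (next x) ≢ x
  next²≢ 2≤n x e = step²≢ 2≤n (toℕ-next x) (toℕ-next (next x)) (cong toℕ e)

  next³≢ : 3 ≤ n → ∀ x → next (next (next x)) ≢ x
  next³≢ 3≤n x e = step³≢ 3≤n (toℕ-next x) (toℕ-next (next x)) (toℕ-next (next (next x))) (cong toℕ e)

  prev≢next : 2 ≤ n → ∀ x → prev x ≢ next x
  prev≢next 2≤n x e = next²≢ 2≤n (prev x) (trans (cong next (next-prev x)) (sym e))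

  module Schedule (small : V → Bool) (1≤n : 1 ≤ n)
                  (independent : ∀ v → small v ≡ true → small (next v) ≡ true → ⊥) where

    private
      smallAt : ℕ → Bool
      smallAt t with t <? suc n
      ... | yes t<k = small (fromℕ< t<k)
      ... | no _ = false

      smallAt-toℕ : ∀ v → smallAt (toℕ v) ≡ small v
      smallAt-toℕ v with toℕ v <? suc n
      ... | yes v<k = cong small (fromℕ<-toℕ v v<k)
      ... | no v≮k = ⊥-elim (v≮k (toℕ<n v))

      -- walk seed t tells whether vertex t is early when a large vertex is late exactly if its
      -- predecessor is early; the seed makes this consistent around the cycle, except that without
      -- small vertices both vertex n and vertex 0 may be early.
      walk : Bool → ℕ → Bool
      walk seed zero = smallAt 0 ∨ seed
      walk seed (suc t) = smallAt (suc t) ∨ not (walk seed t)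

      seed : Bool
      seed = not (walk false n)

      AllLarge : Set
      AllLarge = ∀ v → small v ≡ false

      walk-depends⇒large : ∀ {t} → walk true t ≢ walk false t → ∀ {s} → s ≤ t → smallAt s ≡ false
      walk-depends⇒large {zero} differ z≤n with smallAt 0
      ... | true = ⊥-elim (differ refl)
      ... | false = refl
      walk-depends⇒large {suc t} differ s≤t+1 with smallAt (suc t) in small-t+1
      ... | true = ⊥-elim (differ refl)
      ... | false with m≤n⇒m<n∨m≡n s≤t+1
      ...   | inj₂ refl = small-t+1
      ...   | inj₁ (s≤s s≤t) = walk-depends⇒large (differ ∘ cong not) s≤t

      wrap : smallAt 0 ∨ seed ≡ smallAt 0 ∨ not (walk seed n)
           ⊎ (walk seed n ≡ true × smallAt 0 ∨ seed ≡ true × AllLarge)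
      wrap with walk false n in last₀
      ... | true rewrite last₀ = inj₁ refl
      ... | false with walk true n in last₁
      ...   | false = inj₁ refl
      ...   | true = inj₂ (refl , ∨-zeroʳ (smallAt 0) , λ v →
                trans (sym (smallAt-toℕ v)) (walk-depends⇒large depends (≤-pred (toℕ<n v))))
        where
        depends : walk true n ≢ walk false n
        depends e with () ← trans (sym last₁) (trans e last₀)

    opaque
      early : V → Bool
      early v = walk seed (toℕ v)

    private opaque
      unfolding early
      step : ∀ v → early (next v) ≡ small (next v) ∨ not (early v)
                 ⊎ (toℕ v ≡ n × early v ≡ true × early (next v) ≡ true × AllLarge)
      step v with toℕ-next v
      ... | inj₁ e = inj₁ (begin
        walk seed (toℕ (next v))                         ≡⟨ cong (walk seed) e ⟩
        smallAt (suc (toℕ v)) ∨ not (early v)            ≡⟨ cong (λ t → smallAt t ∨ not (early v)) (sym e) ⟩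
        smallAt (toℕ (next v)) ∨ not (early v)           ≡⟨ cong (_∨ not (early v)) (smallAt-toℕ (next v)) ⟩
        small (next v) ∨ not (early v)                   ∎)
        where open ≡-Reasoning
      ... | inj₂ (v≡n , next≡0) with wrap
      ...   | inj₁ consistent = inj₁ (begin
        walk seed (toℕ (next v))                         ≡⟨ cong (walk seed) next≡0 ⟩
        smallAt 0 ∨ seed                                 ≡⟨ consistent ⟩
        smallAt 0 ∨ not (walk seed n)
          ≡⟨ cong₂ (λ t t′ → smallAt t ∨ not (walk seed t′)) (sym next≡0) (sym v≡n) ⟩
        smallAt (toℕ (next v)) ∨ not (early v)           ≡⟨ cong (_∨ not (early v)) (smallAt-toℕ (next v)) ⟩
        small (next v) ∨ not (early v)                   ∎)
        where open ≡-Reasoning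
      ...   | inj₂ (last-early , first-early , large) =
        inj₂ (v≡n , trans (cong (walk seed) v≡n) last-early ,
              trans (cong (walk seed) next≡0) first-early , large)

      step-into : ∀ v → early v ≡ small v ∨ not (early (prev v))
                      ⊎ (toℕ (prev v) ≡ n × early (prev v) ≡ true × early v ≡ true × AllLarge)
      step-into v = subst (λ w → early w ≡ small w ∨ not (early (prev v))
                                ⊎ (toℕ (prev v) ≡ n × early (prev v) ≡ true × early w ≡ true × AllLarge))
                          (next-prev v) (step (prev v))

    private
      after-early : ∀ u w → early u ≡ true → early w ≡ small w ∨ not (early u) → early w ≡ small w
      after-early u w early-u e = trans e (trans (cong (λ b → small w ∨ not b) early-u) (∨-identityʳ (small w)))

      before-early : ∀ u w → early w ≡ true → small w ≡ false → early w ≡ small w ∨ not (early u) →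
                     early u ≡ false
      before-early u w early-w large-w e =
        not-injective (trans (sym (cong (_∨ not (early u)) large-w)) (trans (sym e) early-w))

    late-neighbours : ∀ v → early v ≡ false → early (prev v) ≡ true × early (next v) ≡ true × small v ≡ false
    late-neighbours v late = proj₂ from-prev , next-early , proj₁ from-prev
      where
      from-prev : small v ≡ false × early (prev v) ≡ true
      from-prev with step-into v
      ... | inj₁ e = ∨-conicalˡ _ _ both-false , not-injective (∨-conicalʳ (small v) _ both-false)
        where
        both-false : small v ∨ not (early (prev v)) ≡ false
        both-false = trans (sym e) late
      ... | inj₂ (_ , _ , early , _) with () ← trans (sym late) early
      next-early : early (next v) ≡ true
      next-early with step v
      ... | inj₁ e = trans e (trans (cong (λ b → small (next v) ∨ not b) late) (∨-zeroʳ _))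
      ... | inj₂ (_ , early , _) with () ← trans (sym late) early

    early-pair : ∀ v → early v ≡ true → early (next v) ≡ true →
                 small v ≡ false × early (prev v) ≡ false × early (next (next v)) ≡ false
    early-pair v early₀ early₁ with step v
    ... | inj₁ e = large-v , prev-late , next²-late
      where
      small-next : small (next v) ≡ true
      small-next = trans (sym (after-early v (next v) early₀ e)) early₁
      large-v : small v ≡ false
      large-v = ¬-not λ small-v → independent v small-v small-next
      prev-late : early (prev v) ≡ false
      prev-late with step-into v
      ... | inj₁ e′ = before-early (prev v) v early₀ large-v e′
      ... | inj₂ (_ , _ , _ , large) with () ← trans (sym small-next) (large (next v))
      next²-late : early (next (next v)) ≡ false
      next²-late with step (next v)
      ... | inj₁ e′ =
        trans (after-early (next v) (next (next v)) early₁ e′) (¬-not (independent (next v) small-next))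
      ... | inj₂ (_ , _ , _ , large) with () ← trans (sym small-next) (large (next v))
    ... | inj₂ (v≡n , _ , _ , large) = large v , prev-late , next²-late
      where
      prev-late : early (prev v) ≡ false
      prev-late with step-into v
      ... | inj₁ e′ = before-early (prev v) v early₀ (large v) e′
      ... | inj₂ (prev≡n , _) =
        ⊥-elim (next≢ 1≤n (prev v) (trans (next-prev v) (toℕ-injective (trans v≡n (sym prev≡n)))))
      next²-late : early (next (next v)) ≡ false
      next²-late with step (next v)
      ... | inj₁ e′ = trans (after-early (next v) (next (next v)) early₁ e′) (large (next (next v)))
      ... | inj₂ (next≡n , _) = ⊥-elim (next≢ 1≤n v (toℕ-injective (trans next≡n (sym v≡n))))

-- The colouring

module Colouring (m n : ℕ) (1≤m : 1 ≤ m) (3≤n : 3 ≤ n) (f : Fin (suc n) → ℕ)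
  (f∈ : ∀ v → f v ≡ 3 * m ⊎ f v ≡ 5 * m)
  (8m≤f+f : ∀ v → 8 * m ≤ f v + f (Cycle.next n v))
  (H : Cover (suc n) (CycAdj (suc n)) f) where

  open Cycle n

  opaque
    small : V → Bool
    small v = ⌊ f v ≟ 3 * m ⌋

    small⇒f≡3m : ∀ {v} → small v ≡ true → f v ≡ 3 * m
    small⇒f≡3m {v} _ with f v ≟ 3 * m
    ... | yes f≡3m = f≡3m

    large⇒f≡5m : ∀ {v} → small v ≡ false → f v ≡ 5 * m
    large⇒f≡5m {v} _ with f v ≟ 3 * m | f∈ v
    ... | no f≢3m | inj₁ f≡3m = ⊥-elim (f≢3m f≡3m)
    ... | no _ | inj₂ f≡5m = f≡5m

  3m≤f : ∀ v → 3 * m ≤ f v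
  3m≤f v with f∈ v
  ... | inj₁ f≡3m = ≤-reflexive (sym f≡3m)
  ... | inj₂ f≡5m = ≤-trans (*-monoˡ-≤ m {3} {5} (s≤s (s≤s (s≤s z≤n)))) (≤-reflexive (sym f≡5m))

  small-independent : ∀ v → small v ≡ true → small (next v) ≡ true → ⊥
  small-independent v s s′ = <⇒≱ 6m<8m (begin
    8 * m                  ≤⟨ 8m≤f+f v ⟩
    f v + f (next v)       ≡⟨ cong₂ _+_ (small⇒f≡3m s) (small⇒f≡3m s′) ⟩
    3 * m + 3 * m          ≡⟨ sym (*-distribʳ-+ m 3 3) ⟩
    6 * m                  ∎)
    where
    open ≤-Reasoning
    6m<8m : 6 * m < 8 * m
    6m<8m = *-monoˡ-< m ⦃ >-nonZero 1≤m ⦄ {6} {8} (s≤s (s≤s (s≤s (s≤s (s≤s (s≤s (s≤s z≤n)))))))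

  1≤n : 1 ≤ n
  1≤n = ≤-trans (s≤s z≤n) 3≤n

  2≤n : 2 ≤ n
  2≤n = ≤-trans (s≤s (s≤s z≤n)) 3≤n

  open Schedule small 1≤n small-independent

  late⇒f≡5m : ∀ {v} → early v ≡ false → f v ≡ 5 * m
  late⇒f≡5m {v} late = large⇒f≡5m (proj₂ (proj₂ (late-neighbours v late)))

  prev-adj : ∀ v → CycAdj (suc n) (prev v) v
  prev-adj v = inj₁ (CycNext-prev v)

  next-adj : ∀ v → CycAdj (suc n) (next v) v
  next-adj v = inj₂ (CycNext-next v)

  Edge : (u v : V) → Fin (f u) → Fin (f v) → Bool
  Edge u v a b = E H u a v b

  Edge-flip : ∀ {u v a b} → Edge u v a b ≡ true → Edge v u b a ≡ true
  Edge-flip {u} {v} {a} {b} e = trans (sym (E-sym H u a v b)) e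

  Edge-matching : ∀ {u v} → CycAdj (suc n) u v → IsMatching (Edge u v)
  Edge-matching {u} {v} u~v = record
    { functional = E-matching H u v u~v _ _ _
    ; injective  = λ {b} {a} {a′} e e′ →
        E-matching H v u (swap u~v) b a a′ (Edge-flip e) (Edge-flip e′)
    }
    where
    swap : CycAdj (suc n) u v → CycAdj (suc n) v u
    swap (inj₁ u→v) = inj₂ u→v
    swap (inj₂ v→u) = inj₁ v→u

  Family : Set
  Family = (v : V) → Subsetᵇ (f v)

  blocked : Family → (w v : V) → Subsetᵇ (f v)
  blocked F w v = image (Edge w v) (F w)

  ∣blocked∣≤ : ∀ F {w v} → CycAdj (suc n) w v → ∣ blocked F w v ∣ ≤ ∣ F w ∣
  ∣blocked∣≤ F {w} w~v = ∣image∣≤∣X∣ (IsMatching.functional (Edge-matching w~v)) (F w)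

  ∈blocked : ∀ F {w v a b} → a ∈ F w → Edge w v a b ≡ true → b ∈ blocked F w v
  ∈blocked F {w} {v} = ∈image⁺ {R = Edge w v} {X = F w}

  place : (j : V) → Subsetᵇ (f (prev j)) → Subsetᵇ (f (next j)) → Family
  place j P Q v with v ≟ᶠ prev j
  ... | yes refl = P
  ... | no _ with v ≟ᶠ next j
  ...   | yes refl = Q
  ...   | no _ = ∅

  place-prev : ∀ j P Q → place j P Q (prev j) ≡ P
  place-prev j P Q with prev j ≟ᶠ prev j
  ... | yes refl = refl
  ... | no prev≢prev = ⊥-elim (prev≢prev refl)

  place-next : ∀ j P Q → place j P Q (next j) ≡ Q
  place-next j P Q with next j ≟ᶠ prev j
  ... | yes next≡prev = ⊥-elim (prev≢next 2≤n j (sym next≡prev))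
  ... | no _ with next j ≟ᶠ next j
  ...   | yes refl = refl
  ...   | no next≢next = ⊥-elim (next≢next refl)

  ∣place∣≤m : ∀ j {P Q} → ∣ P ∣ ≤ m → ∣ Q ∣ ≤ m → ∀ v → ∣ place j P Q v ∣ ≤ m
  ∣place∣≤m j ∣P∣≤m ∣Q∣≤m v with v ≟ᶠ prev j
  ... | yes refl = ∣P∣≤m
  ... | no _ with v ≟ᶠ next j
  ...   | yes refl = ∣Q∣≤m
  ...   | no _ = ≤-trans (≤-reflexive (∣∅∣≡0 {f v})) z≤n

  Reservations : Set
  Reservations = V → Family

  ∅ʳ : Reservations
  ∅ʳ _ _ = ∅

  excludedₗ : Reservations → (j : V) → Subsetᵇ (f (prev j))
  excludedₗ s j = blocked (s (prev (prev (prev j)))) (prev (prev j)) (prev j)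

  excludedᵣ : Reservations → (j : V) → Subsetᵇ (f (next j))
  excludedᵣ s j = blocked (s (next (next (next j)))) (next (next j)) (next j)

  module Reserve (s : Reservations) (j : V) =
    Overlap m (Edge-matching (prev-adj j)) (Edge-matching (next-adj j)) (excludedₗ s j) (excludedᵣ s j)

  reservation : Reservations → V → Family
  reservation s j = if early j then (λ _ → ∅) else place j (Reserve.Pₗ s j) (Reserve.Pᵣ s j)

  reservation-early : ∀ s {j} → early j ≡ true → reservation s j ≡ λ _ → ∅
  reservation-early s {j} e = cong (λ b → if b then (λ _ → ∅) else place j (Reserve.Pₗ s j) (Reserve.Pᵣ s j)) e

  reservation-late : ∀ s {j} → early j ≡ false → reservation s j ≡ place j (Reserve.Pₗ s j) (Reserve.Pᵣ s j)
  reservation-late s {j} e = cong (λ b → if b then (λ _ → ∅) else place j (Reserve.Pₗ s j) (Reserve.Pᵣ s j)) e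

  ∣reservation∣≤m : ∀ s j v → ∣ reservation s j v ∣ ≤ m
  ∣reservation∣≤m s j v with early j
  ... | true = ≤-trans (≤-reflexive (∣∅∣≡0 {f v})) z≤n
  ... | false = ∣place∣≤m j (Reserve.∣Pₗ∣≤m s j) (Reserve.∣Pᵣ∣≤m s j) v

  reservation⊆Pₗ : ∀ s j → reservation s j (prev j) ⊆ Reserve.Pₗ s j
  reservation⊆Pₗ s j {a} a∈ with early j
  ... | true = ⊥-elim (∉∅ a∈)
  ... | false = subst (a ∈_) (place-prev j _ _) a∈

  reservation⊆Pᵣ : ∀ s j → reservation s j (next j) ⊆ Reserve.Pᵣ s j
  reservation⊆Pᵣ s j {a} a∈ with early j
  ... | true = ⊥-elim (∉∅ a∈)
  ... | false = subst (a ∈_) (place-next j _ _) a∈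

  reservation-avoidsₗ : ∀ s j {v w y a c} → prev j ≡ v → prev v ≡ w → prev w ≡ y →
                    a ∈ reservation s j v → c ∈ s y w → Edge w v c a ≡ false
  reservation-avoidsₗ s j refl refl refl a∈ c∈ =
    ¬-not λ Eca → Reserve.Pₗ-avoids s j (reservation⊆Pₗ s j a∈) (∈blocked (s (prev (prev (prev j)))) c∈ Eca)

  reservation-avoidsᵣ : ∀ s j {v w y a c} → next j ≡ v → next v ≡ w → next w ≡ y →
                    a ∈ reservation s j v → c ∈ s y w → Edge w v c a ≡ false
  reservation-avoidsᵣ s j refl refl refl a∈ c∈ =
    ¬-not λ Eca → Reserve.Pᵣ-avoids s j (reservation⊆Pᵣ s j a∈) (∈blocked (s (next (next (next j)))) c∈ Eca)

  squeezed : V → Bool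
  squeezed j = small (prev j) ∧ small (next j)

  -- Late vertices between two small vertices reserve first and exclude nothing; the others follow in
  -- the order of their index, each avoiding clashes with the reservations already made two steps away.
  reservationsBefore : ℕ → Reservations
  reservationsBefore zero j = if squeezed j then reservation ∅ʳ j else λ _ → ∅
  reservationsBefore (suc t) j with squeezed j | toℕ j ≟ t
  ... | false | yes _ = reservation (reservationsBefore t) j
  ... | _ | _ = reservationsBefore t j

  reservations : Reservations
  reservations = reservationsBefore (suc n)

  ∣reservationsBefore∣≤m : ∀ t j v → ∣ reservationsBefore t j v ∣ ≤ m
  ∣reservationsBefore∣≤m zero j v with squeezed j
  ... | true = ∣reservation∣≤m ∅ʳ j v
  ... | false = ≤-trans (≤-reflexive (∣∅∣≡0 {f v})) z≤n
  ∣reservationsBefore∣≤m (suc t) j v with squeezed j | toℕ j ≟ t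
  ... | false | yes _ = ∣reservation∣≤m (reservationsBefore t) j v
  ... | false | no _ = ∣reservationsBefore∣≤m t j v
  ... | true | _ = ∣reservationsBefore∣≤m t j v

  reservationsBefore-squeezed : ∀ {j} → squeezed j ≡ true → ∀ t → reservationsBefore t j ≡ reservation ∅ʳ j
  reservationsBefore-squeezed {j} sq zero rewrite sq = refl
  reservationsBefore-squeezed {j} _ (suc t) with squeezed j in sq | toℕ j ≟ t
  ... | true | _ = reservationsBefore-squeezed {j} sq t

  reservationsBefore-processed : ∀ {j} → squeezed j ≡ false → ∀ {t} → toℕ j < t →
                           reservationsBefore t j ≡ reservation (reservationsBefore (toℕ j)) j
  reservationsBefore-processed {j} _ {suc t} j<t+1 with squeezed j in sq | toℕ j ≟ t
  ... | false | yes refl = refl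
  ... | false | no j≢t = reservationsBefore-processed {j} sq (≤∧≢⇒< (≤-pred j<t+1) j≢t)

  reservationsBefore-final : ∀ {j t} → squeezed j ≡ true ⊎ toℕ j < t → reservationsBefore t j ≡ reservations j
  reservationsBefore-final {j} {t} (inj₁ sq) =
    trans (reservationsBefore-squeezed {j} sq t) (sym (reservationsBefore-squeezed {j} sq (suc n)))
  reservationsBefore-final {j} {t} (inj₂ j<t) with squeezed j ≟ᵇ true
  ... | yes sq = reservationsBefore-final {j} {t} (inj₁ sq)
  ... | no ¬sq = trans (reservationsBefore-processed {j} (¬-not ¬sq) j<t)
                       (sym (reservationsBefore-processed {j} (¬-not ¬sq) (toℕ<n j)))

  ∣excludedₗ∣≤ : ∀ s j {k} → (∀ j v → ∣ s j v ∣ ≤ k) → ∣ excludedₗ s j ∣ ≤ k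
  ∣excludedₗ∣≤ s j bound = ≤-trans (∣blocked∣≤ (s (prev (prev (prev j)))) (prev-adj (prev j))) (bound _ _)

  ∣excludedᵣ∣≤ : ∀ s j {k} → (∀ j v → ∣ s j v ∣ ≤ k) → ∣ excludedᵣ s j ∣ ≤ k
  ∣excludedᵣ∣≤ s j bound = ≤-trans (∣blocked∣≤ (s (next (next (next j)))) (next-adj (next j))) (bound _ _)

  Room : Reservations → V → Set
  Room s j = ∣ excludedₗ s j ∣ + ∣ excludedᵣ s j ∣ + (f j + m) ≤ f (prev j) + f (next j)

  unsqueezed⇒8m≤ : ∀ {j} → squeezed j ≡ false → 8 * m ≤ f (prev j) + f (next j)
  unsqueezed⇒8m≤ {j} unsq with small (prev j) in sₗ
  ... | false = begin
    8 * m                      ≡⟨ *-distribʳ-+ m 5 3 ⟩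
    5 * m + 3 * m              ≤⟨ +-mono-≤ (≤-reflexive (sym (large⇒f≡5m sₗ))) (3m≤f (next j)) ⟩
    f (prev j) + f (next j)    ∎
    where open ≤-Reasoning
  ... | true = begin
    8 * m                      ≡⟨ *-distribʳ-+ m 3 5 ⟩
    3 * m + 5 * m              ≤⟨ +-mono-≤ (3m≤f (prev j)) (≤-reflexive (sym (large⇒f≡5m unsq))) ⟩
    f (prev j) + f (next j)    ∎
    where open ≤-Reasoning

  reservations-room : ∀ j → early j ≡ false → ∃[ s ] reservations j ≡ reservation s j × Room s j
  reservations-room j late with squeezed j ≟ᵇ true
  ... | yes sq = ∅ʳ , reservationsBefore-squeezed {j} sq (suc n) , (begin
    ∣ excludedₗ ∅ʳ j ∣ + ∣ excludedᵣ ∅ʳ j ∣ + (f j + m)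
      ≤⟨ +-mono-≤ (+-mono-≤ (∣excludedₗ∣≤ ∅ʳ j empty) (∣excludedᵣ∣≤ ∅ʳ j empty))
                  (≤-reflexive (cong (_+ m) (late⇒f≡5m late))) ⟩
    0 + 0 + (5 * m + m)        ≡⟨ arith m ⟩
    3 * m + 3 * m
      ≡⟨ sym (cong₂ _+_ (small⇒f≡3m (∧-conicalˡ _ _ sq)) (small⇒f≡3m (∧-conicalʳ _ _ sq))) ⟩
    f (prev j) + f (next j)    ∎)
    where
    open ≤-Reasoning
    empty : ∀ j v → ∣ ∅ʳ j v ∣ ≤ 0
    empty _ v = ≤-reflexive (∣∅∣≡0 {f v})
    arith : ∀ m → 0 + 0 + (5 * m + m) ≡ 3 * m + 3 * m
    arith = solve-∀
  ... | no ¬sq = reservationsBefore (toℕ j) , reservationsBefore-processed {j} (¬-not ¬sq) (toℕ<n j) , (begin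
    ∣ excludedₗ s j ∣ + ∣ excludedᵣ s j ∣ + (f j + m)
      ≤⟨ +-mono-≤ (+-mono-≤ (∣excludedₗ∣≤ s j (∣reservationsBefore∣≤m (toℕ j)))
                            (∣excludedᵣ∣≤ s j (∣reservationsBefore∣≤m (toℕ j))))
                  (≤-reflexive (cong (_+ m) (late⇒f≡5m late))) ⟩
    m + m + (5 * m + m)        ≡⟨ arith m ⟩
    8 * m                      ≤⟨ unsqueezed⇒8m≤ (¬-not ¬sq) ⟩
    f (prev j) + f (next j)    ∎)
    where
    open ≤-Reasoning
    s = reservationsBefore (toℕ j)
    arith : ∀ m → m + m + (5 * m + m) ≡ 8 * m
    arith = solve-∀

  reservations-early : ∀ {j} → early j ≡ true → ∀ {v a} → a ∉ reservations j v
  reservations-early {j} e {v} {a} a∈ with squeezed j ≟ᵇ true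
  ... | yes sq = ∉∅ (subst (λ F → a ∈ F v) (trans (reservationsBefore-squeezed {j} sq (suc n))
                                                 (reservation-early ∅ʳ e)) a∈)
  ... | no ¬sq = ∉∅ (subst (λ F → a ∈ F v) (trans (reservationsBefore-processed {j} (¬-not ¬sq) (toℕ<n j))
                                                 (reservation-early (reservationsBefore (toℕ j)) e)) a∈)

  ∣reservations∣≤m : ∀ j v → ∣ reservations j v ∣ ≤ m
  ∣reservations∣≤m = ∣reservationsBefore∣≤m (suc n)

  reserved : Family
  reserved v = reservations (prev v) v ∪ reservations (next v) v

  ∣reserved∣≤2m : ∀ v → ∣ reserved v ∣ ≤ 2 * m
  ∣reserved∣≤2m v = begin
    ∣ reserved v ∣                                             ≤⟨ ∣p∪q∣≤∣p∣+∣q∣ (reservations (prev v) v) _ ⟩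
    ∣ reservations (prev v) v ∣ + ∣ reservations (next v) v ∣  ≤⟨ +-mono-≤ (∣reservations∣≤m (prev v) v)
                                                                            (∣reservations∣≤m (next v) v) ⟩
    m + m                                                      ≡⟨ cong (m +_) (sym (+-identityʳ m)) ⟩
    2 * m                                                      ∎
    where open ≤-Reasoning

  ∣reserved∣≤m : ∀ {v} → early (next v) ≡ true → ∣ reserved v ∣ ≤ m
  ∣reserved∣≤m {v} e = ≤-trans (p⊆q⇒∣p∣≤∣q∣ {p = reserved v} only-prev) (∣reservations∣≤m (prev v) v)
    where
    only-prev : reserved v ⊆ reservations (prev v) v
    only-prev a∈ with ∈∪⁻ a∈
    ... | inj₁ a∈prev = a∈prev
    ... | inj₂ a∈next = ⊥-elim (reservations-early e a∈next)

  prev-reservation⇒reserved : ∀ {j a} → a ∈ reservations j (prev j) → a ∈ reserved (prev j)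
  prev-reservation⇒reserved {j} {a} a∈ = ∈∪⁺ʳ (subst (λ w → a ∈ reservations w (prev j)) (sym (next-prev j)) a∈)

  next-reservation⇒reserved : ∀ {j a} → a ∈ reservations j (next j) → a ∈ reserved (next j)
  next-reservation⇒reserved {j} {a} a∈ = ∈∪⁺ˡ (subst (λ w → a ∈ reservations w (next j)) (sym (prev-next j)) a∈)

  -- Of the two late vertices around the run u, next u, the one that reserved later avoided the other.
  reserved-pair : ∀ u → early u ≡ true → early (next u) ≡ true →
                  ∀ {x y} → x ∈ reserved u → y ∈ reserved (next u) → Edge u (next u) x y ≡ false
  reserved-pair u early₀ early₁ {x} {y} x∈ y∈ = by-order (squeezed j₂ ≟ᵇ true) (<-cmp (toℕ j₁) (toℕ j₂))
    where
    j₁ j₂ : V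
    j₁ = prev u
    j₂ = next (next u)

    x∈j₁ : x ∈ reservations j₁ u
    x∈j₁ with ∈∪⁻ x∈
    ... | inj₁ x∈′ = x∈′
    ... | inj₂ x∈′ = ⊥-elim (reservations-early {next u} early₁ x∈′)

    y∈j₂ : y ∈ reservations j₂ (next u)
    y∈j₂ with ∈∪⁻ y∈
    ... | inj₁ y∈′ =
      ⊥-elim (reservations-early {u} early₀ (subst (λ w → y ∈ reservations w (next u)) (prev-next u) y∈′))
    ... | inj₂ y∈′ = y∈′

    j₁-unsqueezed : squeezed j₁ ≡ false
    j₁-unsqueezed = trans (cong (λ w → small (prev j₁) ∧ small w) (next-prev u))
                          (trans (cong (small (prev j₁) ∧_) (proj₁ (early-pair u early₀ early₁))) (∧-zeroʳ _))

    excluded-by-j₁ : squeezed j₂ ≡ true ⊎ toℕ j₂ < toℕ j₁ → Edge u (next u) x y ≡ false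
    excluded-by-j₁ j₂-first = trans (E-sym H u x (next u) y)
      (reservation-avoidsᵣ s j₁ (next-prev u) refl refl
        (subst (λ F → x ∈ F u) (reservationsBefore-processed {j₁} j₁-unsqueezed (toℕ<n j₁)) x∈j₁)
        (subst (λ F → y ∈ F (next u)) (sym (reservationsBefore-final {j₂} j₂-first)) y∈j₂))
      where s = reservationsBefore (toℕ j₁)

    excluded-by-j₂ : squeezed j₂ ≡ false → toℕ j₁ < toℕ j₂ → Edge u (next u) x y ≡ false
    excluded-by-j₂ j₂-unsqueezed j₁<j₂ =
      reservation-avoidsₗ s j₂ (prev-next (next u)) (prev-next u) refl
        (subst (λ F → y ∈ F (next u)) (reservationsBefore-processed {j₂} j₂-unsqueezed (toℕ<n j₂)) y∈j₂)
        (subst (λ F → x ∈ F u) (sym (reservationsBefore-final {j₁} (inj₂ j₁<j₂))) x∈j₁)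
      where s = reservationsBefore (toℕ j₂)

    by-order : Dec (squeezed j₂ ≡ true) → Tri (toℕ j₁ < toℕ j₂) (toℕ j₁ ≡ toℕ j₂) (toℕ j₁ > toℕ j₂) →
               Edge u (next u) x y ≡ false
    by-order (yes sq₂) _ = excluded-by-j₁ (inj₁ sq₂)
    by-order (no _) (tri> _ _ j₂<j₁) = excluded-by-j₁ (inj₂ j₂<j₁)
    by-order (no ¬sq₂) (tri< j₁<j₂ _ _) = excluded-by-j₂ (¬-not ¬sq₂) j₁<j₂
    by-order (no _) (tri≈ _ j₁≡j₂ _) =
      ⊥-elim (next³≢ 3≤n j₁ (trans (cong (next ∘ next) (next-prev u)) (sym (toℕ-injective j₁≡j₂))))

  -- The second vertex of a run of two early vertices is coloured in the first pass, the first vertex in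
  -- the second pass.
  firstPass : Family
  firstPass v = extendTo (2 * m) (reserved v) (blocked reserved (prev v) v)

  secondPass : Family
  secondPass v = extendTo (2 * m) (reserved v) (blocked reserved (prev v) v ∪ blocked firstPass (next v) v)

  colourEarly : Family
  colourEarly v = if early (next v) then secondPass v else firstPass v

  forbidden : Family
  forbidden v = blocked colourEarly (prev v) v ∪ blocked colourEarly (next v) v

  colourLate : Family
  colourLate v = extendTo (2 * m) ∅ (forbidden v)

  colour : Family
  colour v = if early v then colourEarly v else colourLate v

  colourEarly-first : ∀ {v} → early (next v) ≡ false → colourEarly v ≡ firstPass v
  colourEarly-first {v} e = cong (λ b → if b then secondPass v else firstPass v) e

  colourEarly-second : ∀ {v} → early (next v) ≡ true → colourEarly v ≡ secondPass v
  colourEarly-second {v} e = cong (λ b → if b then secondPass v else firstPass v) e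

  reserved⊆colourEarly : ∀ v → reserved v ⊆ colourEarly v
  reserved⊆colourEarly v with early (next v)
  ... | true = ⊆extendTo
  ... | false = ⊆extendTo

  ∣blocked-reserved∣≤m : ∀ {v} → early v ≡ true → ∣ blocked reserved (prev v) v ∣ ≤ m
  ∣blocked-reserved∣≤m {v} e =
    ≤-trans (∣blocked∣≤ reserved (prev-adj v)) (∣reserved∣≤m (trans (cong early (next-prev v)) e))

  ∣firstPass∣ : ∀ {v} → early v ≡ true → ∣ firstPass v ∣ ≡ 2 * m
  ∣firstPass∣ {v} e = ∣extendTo∣ (∣reserved∣≤2m v) (begin
    2 * m + ∣ blocked reserved (prev v) v ∣    ≤⟨ +-monoʳ-≤ (2 * m) (∣blocked-reserved∣≤m e) ⟩
    2 * m + m                                  ≡⟨ arith m ⟩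
    3 * m                                      ≤⟨ 3m≤f v ⟩
    f v                                        ∎)
    where
    open ≤-Reasoning
    arith : ∀ m → 2 * m + m ≡ 3 * m
    arith = solve-∀

  ∣secondPass∣ : ∀ {v} → early v ≡ true → early (next v) ≡ true → ∣ secondPass v ∣ ≡ 2 * m
  ∣secondPass∣ {v} e₀ e₁ = ∣extendTo∣ (∣reserved∣≤2m v) (begin
    2 * m + ∣ blocked reserved (prev v) v ∪ blocked firstPass (next v) v ∣
      ≤⟨ +-monoʳ-≤ (2 * m) (∣p∪q∣≤∣p∣+∣q∣ (blocked reserved (prev v) v) (blocked firstPass (next v) v)) ⟩
    2 * m + (∣ blocked reserved (prev v) v ∣ + ∣ blocked firstPass (next v) v ∣)
      ≤⟨ +-monoʳ-≤ (2 * m) (+-mono-≤ (∣blocked-reserved∣≤m e₀)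
           (≤-trans (∣blocked∣≤ firstPass (next-adj v)) (≤-reflexive (∣firstPass∣ e₁)))) ⟩
    2 * m + (m + 2 * m)                        ≡⟨ arith m ⟩
    5 * m                                      ≡⟨ sym (large⇒f≡5m (proj₁ (early-pair v e₀ e₁))) ⟩
    f v                                        ∎)
    where
    open ≤-Reasoning
    arith : ∀ m → 2 * m + (m + 2 * m) ≡ 5 * m
    arith = solve-∀

  ∣colourEarly∣ : ∀ {v} → early v ≡ true → ∣ colourEarly v ∣ ≡ 2 * m
  ∣colourEarly∣ {v} e with early (next v) ≟ᵇ true
  ... | yes e₁ = trans (cong ∣_∣ (colourEarly-second e₁)) (∣secondPass∣ e e₁)
  ... | no ¬e₁ = trans (cong ∣_∣ (colourEarly-first (¬-not ¬e₁))) (∣firstPass∣ e)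

  Pₗ⊆reservation : ∀ s j → early j ≡ false → Reserve.Pₗ s j ⊆ reservation s j (prev j)
  Pₗ⊆reservation s j late {a} a∈ =
    subst (λ F → a ∈ F (prev j)) (sym (reservation-late s late)) (subst (a ∈_) (sym (place-prev j _ _)) a∈)

  Pᵣ⊆reservation : ∀ s j → early j ≡ false → Reserve.Pᵣ s j ⊆ reservation s j (next j)
  Pᵣ⊆reservation s j late {a} a∈ =
    subst (λ F → a ∈ F (next j)) (sym (reservation-late s late)) (subst (a ∈_) (sym (place-next j _ _)) a∈)

  ∣forbidden∣≤3m : ∀ {v} → early v ≡ false → ∣ forbidden v ∣ ≤ 3 * m
  ∣forbidden∣≤3m {v} late with reservations-room v late
  ... | s , reservations≡ , room = +-cancelʳ-≤ m _ (3 * m) (begin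
    ∣ forbidden v ∣ + m
      ≤⟨ Reserve.∣image∪image∣+m≤∣Sₗ∣+∣Sᵣ∣ s v room Pₗ⊆ Pᵣ⊆ ⟩
    ∣ colourEarly (prev v) ∣ + ∣ colourEarly (next v) ∣
      ≡⟨ cong₂ _+_ (∣colourEarly∣ (proj₁ (late-neighbours v late)))
                   (∣colourEarly∣ (proj₁ (proj₂ (late-neighbours v late)))) ⟩
    2 * m + 2 * m                              ≡⟨ arith m ⟩
    3 * m + m                                  ∎)
    where
    open ≤-Reasoning
    arith : ∀ m → 2 * m + 2 * m ≡ 3 * m + m
    arith = solve-∀
    Pₗ⊆ : Reserve.Pₗ s v ⊆ colourEarly (prev v)
    Pₗ⊆ {a} a∈ = reserved⊆colourEarly (prev v) (prev-reservation⇒reserved {v}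
                   (subst (λ F → a ∈ F (prev v)) (sym reservations≡) (Pₗ⊆reservation s v late a∈)))
    Pᵣ⊆ : Reserve.Pᵣ s v ⊆ colourEarly (next v)
    Pᵣ⊆ {a} a∈ = reserved⊆colourEarly (next v) (next-reservation⇒reserved {v}
                   (subst (λ F → a ∈ F (next v)) (sym reservations≡) (Pᵣ⊆reservation s v late a∈)))

  ∣colourLate∣ : ∀ {v} → early v ≡ false → ∣ colourLate v ∣ ≡ 2 * m
  ∣colourLate∣ {v} late = ∣extendTo∣ (≤-trans (≤-reflexive (∣∅∣≡0 {f v})) z≤n) (begin
    2 * m + ∣ forbidden v ∣                    ≤⟨ +-monoʳ-≤ (2 * m) (∣forbidden∣≤3m late) ⟩
    2 * m + 3 * m                              ≡⟨ sym (*-distribʳ-+ m 2 3) ⟩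
    5 * m                                      ≡⟨ sym (late⇒f≡5m late) ⟩
    f v                                        ∎)
    where open ≤-Reasoning

  ∣colour∣ : ∀ v → ∣ colour v ∣ ≡ 2 * m
  ∣colour∣ v with early v ≟ᵇ true
  ... | yes e = trans (cong (λ b → ∣ if b then colourEarly v else colourLate v ∣) e) (∣colourEarly∣ e)
  ... | no ¬e = trans (cong (λ b → ∣ if b then colourEarly v else colourLate v ∣) (¬-not ¬e))
                      (∣colourLate∣ (¬-not ¬e))

  colour-independent-next : ∀ u {x y} → x ∈ colour u → y ∈ colour (next u) → Edge u (next u) x y ≡ false
  colour-independent-next u {x} {y} x∈ y∈ with early u in e₀ | early (next u) in e₁
  ... | true | true = ¬-not λ Exy → case Exy (reserved-pair u e₀ e₁ (x∈reserved Exy) (y∈reserved Exy))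
    where
    y∈first : y ∈ firstPass (next u)
    y∈first = subst (y ∈_) (colourEarly-first (proj₂ (proj₂ (early-pair u e₀ e₁)))) y∈
    x∈reserved : Edge u (next u) x y ≡ true → x ∈ reserved u
    x∈reserved Exy = extendTo-avoids x∈ (∈∪⁺ʳ (∈blocked firstPass y∈first (Edge-flip Exy)))
    y∈reserved : Edge u (next u) x y ≡ true → y ∈ reserved (next u)
    y∈reserved Exy = extendTo-avoids y∈first
      (subst (λ w → y ∈ blocked reserved w (next u)) (sym (prev-next u))
             (∈blocked reserved (x∈reserved Exy) Exy))
    case : Edge u (next u) x y ≡ true → Edge u (next u) x y ≡ false → ⊥
    case t f with () ← trans (sym t) f
  ... | true | false = ¬-not λ Exy →
    ∉∅ (extendTo-avoids y∈ (∈∪⁺ˡ (subst (λ w → y ∈ blocked colourEarly w (next u)) (sym (prev-next u))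
      (∈blocked colourEarly (subst (x ∈_) (sym (colourEarly-first e₁)) x∈) Exy))))
  ... | false | true = ¬-not λ Exy →
    ∉∅ (extendTo-avoids x∈ (∈∪⁺ʳ (∈blocked colourEarly y∈ (Edge-flip Exy))))
  ... | false | false with () ← trans (sym (proj₁ (proj₂ (late-neighbours u e₀)))) e₁

  colour-independent-adjacent : ∀ {u v} → CycAdj (suc n) u v → ∀ {a b} → a ∈ colour u → b ∈ colour v →
                                E H u a v b ≡ false
  colour-independent-adjacent {u} (inj₁ u→v) a∈ b∈ with CycNext⇒≡next u→v
  ... | refl = colour-independent-next u a∈ b∈
  colour-independent-adjacent {u} {v} (inj₂ v→u) {a} {b} a∈ b∈ with CycNext⇒≡next v→u
  ... | refl = trans (E-sym H u a v b) (colour-independent-next v b∈ a∈)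

  colour-quasi-independent : ∀ u a v b → u ≢ v → a ∈ colour u → b ∈ colour v → E H u a v b ≡ false
  colour-quasi-independent u a v b u≢v a∈ b∈ = ¬-not λ Euv → neighbours Euv (E-closedNbhd H u a v b Euv)
    where
    neighbours : E H u a v b ≡ true → u ≡ v ⊎ CycAdj (suc n) u v → ⊥
    neighbours _ (inj₁ u≡v) = u≢v u≡v
    neighbours Euv (inj₂ u~v) with () ← trans (sym Euv) (colour-independent-adjacent u~v a∈ b∈)

mainTheorem9 : (m k : ℕ) → 1 ≤ m → 4 ≤ k → (f : Fin k → ℕ) →
    (∀ i → (f i ≡ 3 * m) ⊎ (f i ≡ 5 * m)) →
    (∀ i j → CycNext k i j → 8 * m ≤ f i + f j) →
    DPColorable k (CycAdj k) f (λ _ → 2 * m)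
mainTheorem9 m (suc n) 1≤m (s≤s 3≤n) f f∈ 8m≤f+f H = record
  { S          = λ v → toSubset (colour v)
  ; quasiIndep = λ u a v b u≢v a∈ b∈ → colour-quasi-independent u a v b u≢v (∈toSubset⁻ a∈) (∈toSubset⁻ b∈)
  ; size       = λ v → trans (∣toSubset∣ (colour v)) (∣colour∣ v)
  }
  where
  open Colouring m n 1≤m 3≤n f f∈ (λ i → 8m≤f+f i (Cycle.next n i) (Cycle.CycNext-next n i)) H
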